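{- Let $L$ and $M$ be bounded lattices, with bounds $0_L,1_L$ and $0_M,1_M$ respectively. Let $r: L \to M$ be a retraction with pseudo-inverse $s: M \to L$, i.e. $r$ is a lattice homomorphism, $s$ is a lattice monomorphism, and $r\circ s = \mathrm{Id}_M$. Suppose that for all $x \in L$: $r(x) = 0_M \Leftrightarrow x = 0_L$, and $r(x) = 1_M \Leftrightarrow x = 1_L$. Let $G: M^2 \to M$ be a quasi-grouping function on $M$. Then the function $G^{E}: L^2 \to L$ defined by $G^{E}(x,y) = s(G(r(x), r(y)))$ is a quasi-grouping function on $L$ which extends $G$ from $M$ to $L$, i.e. $G^{E}\circ(s\times s) = s\circ G$ (that is, $G^E(s(x),s(y)) = s(G(x,y))$ for all $x,y\in M$).
   Context: A quasi-grouping function on a bounded lattice $L$ is a map $G: L^2\to L$ such that for all $x,y,z\in L$: (i) $G(x,y)=G(y,x)$; (ii) $G(x,y)=0_L$ iff $x=0_L$ and $y=0_L$; (iii) $G(x,y)=1_L$ iff $x=1_L$ or $y=1_L$; (iv) $G(x,y)\le_L G(x,z)$ whenever $y\le_L z$. Following Palmeira and Bedregal, $M$ is regarded as a (generalized) sublattice of $L$ via a lattice monomorphism $s: M\to L$; a retraction is a lattice homomorphism $r: L\to M$ for which there exists a monomorphism $s: M\to L$ (its pseudo-inverse) with $r\circ s=\mathrm{Id}_M$. Lattice homomorphisms preserve binary meets and joins (hence are increasing). -}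

module Defs where

open import Level using (Level; _⊔_)
open import Data.Product using (_×_)
open import Data.Sum using (_⊎_)
open import Function.Base using (_∘_)
open import Relation.Binary.Lattice.Bundles using (BoundedLattice)

-- Lattices are setoid-based (stdlib BoundedLattice); "functions" between
-- carriers are required to respect the underlying equality _≈_.

module _ {c ℓ₁ ℓ₂ : Level} (L : BoundedLattice c ℓ₁ ℓ₂) where
  open BoundedLattice L

  record IsQuasiGrouping (G : Carrier → Carrier → Carrier) : Set (c ⊔ ℓ₁ ⊔ ℓ₂) where
    field
      cong      : ∀ {x x′ y y′} → x ≈ x′ → y ≈ y′ → G x y ≈ G x′ y′
      symmetric : ∀ x y → G x y ≈ G y x
      zero⇒     : ∀ x y → G x y ≈ ⊥ → (x ≈ ⊥ × y ≈ ⊥)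
      ⇒zero     : ∀ x y → (x ≈ ⊥ × y ≈ ⊥) → G x y ≈ ⊥
      one⇒      : ∀ x y → G x y ≈ ⊤ → (x ≈ ⊤ ⊎ y ≈ ⊤)
      ⇒one      : ∀ x y → (x ≈ ⊤ ⊎ y ≈ ⊤) → G x y ≈ ⊤
      monotone  : ∀ x y z → y ≤ z → G x y ≤ G x z

module _ {a ℓa ℓa′ b ℓb ℓb′ : Level}
         (L : BoundedLattice a ℓa ℓa′) (M : BoundedLattice b ℓb ℓb′) where
  private
    module L = BoundedLattice L
    module M = BoundedLattice M

  record IsLatticeHom (f : L.Carrier → M.Carrier) : Set (a ⊔ ℓa ⊔ b ⊔ ℓb) where
    field
      cong   : ∀ {x y} → x L.≈ y → f x M.≈ f y
      ∧-hom  : ∀ x y → f (x L.∧ y) M.≈ (f x M.∧ f y)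
      ∨-hom  : ∀ x y → f (x L.∨ y) M.≈ (f x M.∨ f y)

  record IsLatticeMono (f : L.Carrier → M.Carrier) : Set (a ⊔ ℓa ⊔ b ⊔ ℓb) where
    field
      isHom     : IsLatticeHom f
      injective : ∀ {x y} → f x M.≈ f y → x L.≈ y

module Submission where

open import Defs
open import Level using (Level)
open import Data.Product using (_×_; _,_; map)
open import Data.Sum using (_⊎_) renaming (map to ⊎-map)
open import Function.Bundles using (_⇔_; module Equivalence)
open import Relation.Binary.Lattice.Bundles using (BoundedLattice)
open import Relation.Binary.Lattice.Properties.MeetSemilattice using (y≤x⇒x∧y≈y)
import Relation.Binary.Reasoning.PartialOrder as ≤-Reasoning

open Equivalence using (to; from)

module _ {a ℓa ℓa′ b ℓb ℓb′ : Level}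
         {L : BoundedLattice a ℓa ℓa′} {M : BoundedLattice b ℓb ℓb′}
         {f : BoundedLattice.Carrier L → BoundedLattice.Carrier M} where
  private
    module L = BoundedLattice L
    module M = BoundedLattice M

  IsLatticeHom⇒monotone : IsLatticeHom L M f → ∀ {y z} → y L.≤ z → f y M.≤ f z
  IsLatticeHom⇒monotone hom {y} {z} y≤z = begin
    f y          ≈⟨ cong (L.Eq.sym (y≤x⇒x∧y≈y L.meetSemilattice y≤z)) ⟩
    f (z L.∧ y)  ≈⟨ ∧-hom z y ⟩
    f z M.∧ f y  ≤⟨ M.x∧y≤x (f z) (f y) ⟩
    f z          ∎
    where
    open IsLatticeHom hom
    open ≤-Reasoning M.poset

module _ {a ℓa ℓa′ b ℓb ℓb′ : Level}
         {L : BoundedLattice a ℓa ℓa′} {M : BoundedLattice b ℓb ℓb′}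
         {r : BoundedLattice.Carrier L → BoundedLattice.Carrier M}
         {s : BoundedLattice.Carrier M → BoundedLattice.Carrier L} where
  private
    module L = BoundedLattice L
    module M = BoundedLattice M

  conjugate-isQuasiGrouping :
    IsLatticeHom L M r → IsLatticeMono M L s →
    (∀ x → r x M.≈ M.⊥ ⇔ x L.≈ L.⊥) → (∀ x → r x M.≈ M.⊤ ⇔ x L.≈ L.⊤) →
    s M.⊥ L.≈ L.⊥ → s M.⊤ L.≈ L.⊤ →
    ∀ {G} → IsQuasiGrouping M G → IsQuasiGrouping L (λ x y → s (G (r x) (r y)))
  conjugate-isQuasiGrouping r-hom s-mono r-⊥ r-⊤ s-⊥ s-⊤ {G} G-qg = record
    { cong      = λ x≈x′ y≈y′ → S.cong (Q.cong (R.cong x≈x′) (R.cong y≈y′))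
    ; symmetric = λ x y → S.cong (Q.symmetric (r x) (r y))
    ; zero⇒     = λ x y e → map (to (r-⊥ x)) (to (r-⊥ y))
                              (Q.zero⇒ (r x) (r y) (s-reflects s-⊥ e))
    ; ⇒zero     = λ x y p → L.Eq.trans
                              (S.cong (Q.⇒zero (r x) (r y) (map (from (r-⊥ x)) (from (r-⊥ y)) p)))
                              s-⊥
    ; one⇒      = λ x y e → ⊎-map (to (r-⊤ x)) (to (r-⊤ y))
                              (Q.one⇒ (r x) (r y) (s-reflects s-⊤ e))
    ; ⇒one      = λ x y p → L.Eq.trans
                              (S.cong (Q.⇒one (r x) (r y) (⊎-map (from (r-⊤ x)) (from (r-⊤ y)) p)))
                              s-⊤
    ; monotone  = λ x y z y≤z → IsLatticeHom⇒monotone S.isHom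
                              (Q.monotone (r x) (r y) (r z) (IsLatticeHom⇒monotone r-hom y≤z))
    }
    where
    module R = IsLatticeHom r-hom
    module S where
      open IsLatticeMono s-mono public
      open IsLatticeHom isHom public
    module Q = IsQuasiGrouping G-qg

    s-reflects : ∀ {u v c} → s v L.≈ c → s u L.≈ c → u M.≈ v
    s-reflects sv≈c su≈c = S.injective (L.Eq.trans su≈c (L.Eq.sym sv≈c))

theorem2 : ∀ {a ℓa ℓa′ b ℓb ℓb′}
    (L : BoundedLattice a ℓa ℓa′) (M : BoundedLattice b ℓb ℓb′)
    (r : BoundedLattice.Carrier L → BoundedLattice.Carrier M)
    (s : BoundedLattice.Carrier M → BoundedLattice.Carrier L) →
    IsLatticeHom L M r →
    IsLatticeMono M L s →
    (∀ x → BoundedLattice._≈_ M (r (s x)) x) →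
    (∀ x → BoundedLattice._≈_ M (r x) (BoundedLattice.⊥ M) ⇔ BoundedLattice._≈_ L x (BoundedLattice.⊥ L)) →
    (∀ x → BoundedLattice._≈_ M (r x) (BoundedLattice.⊤ M) ⇔ BoundedLattice._≈_ L x (BoundedLattice.⊤ L)) →
    (G : BoundedLattice.Carrier M → BoundedLattice.Carrier M → BoundedLattice.Carrier M) →
    IsQuasiGrouping M G →
    IsQuasiGrouping L (λ x y → s (G (r x) (r y)))
    × (∀ x y → BoundedLattice._≈_ L (s (G (r (s x)) (r (s y)))) (s (G x y)))
theorem2 L M r s r-hom s-mono r∘s≈id r-⊥ r-⊤ G G-qg =
  conjugate-isQuasiGrouping r-hom s-mono r-⊥ r-⊤ s-⊥ s-⊤ G-qg ,
  λ x y → IsLatticeHom.cong (IsLatticeMono.isHom s-mono)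
            (IsQuasiGrouping.cong G-qg (r∘s≈id x) (r∘s≈id y))
  where
  module L = BoundedLattice L
  module M = BoundedLattice M
  -- s fixes the bounds because r detects them and r (s ⊥) ≈ ⊥, r (s ⊤) ≈ ⊤.
  s-⊥ : s M.⊥ L.≈ L.⊥
  s-⊥ = to (r-⊥ (s M.⊥)) (r∘s≈id M.⊥)
  s-⊤ : s M.⊤ L.≈ L.⊤
  s-⊤ = to (r-⊤ (s M.⊤)) (r∘s≈id M.⊤)
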